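{- For every integer $s\ge 3$, the generalized Petersen graph $GP(2s+1,s)$ has Frank number $2$.
   Context: The generalized Petersen graph $GP(n,k)$ has vertices $u_1,\dots,u_n,v_1,\dots,v_n$ and edges $u_iu_{i+1}$, $u_iv_i$, and $v_iv_{i+k}$ for $1\le i\le n$, indices taken modulo $n$. An orientation of a graph replaces each edge $uv$ by exactly one of the arcs $(u,v)$, $(v,u)$. An oriented graph is strongly connected if for any two vertices $x,y$ there is a directed $(x,y)$-path. In an orientation $O$ of $G$, an edge $e$ is deletable if $O-e$ is strongly connected. For a $3$-edge-connected graph $G$, the Frank number $F(G)$ is the minimum $k$ such that $G$ admits $k$ orientations with the property that every edge of $G$ is deletable in at least one of them. -}

module Defs where

open import Data.Nat using (ℕ; suc; _+_; _*_; _<_; NonZero)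
open import Data.Nat.DivMod using (_mod_)
open import Data.Fin using (Fin; toℕ)
open import Data.Bool using (Bool; true; false)
open import Data.Product using (Σ; ∃; _×_; _,_; proj₁; proj₂)
open import Relation.Binary.PropositionalEquality using (_≡_)
open import Relation.Nullary using (¬_)

-- Undirected (multi)graphs: a vertex type, an edge type, and the two
-- endpoints of each edge (listed in an arbitrary reference order).

record Graph : Set₁ where
  field
    V    : Set
    E    : Set
    ends : E → V × V
open Graph public

record Digraph : Set₁ where
  field
    DV  : Set
    A   : Set
    arc : A → DV × DV        -- (tail , head)
open Digraph public

-- directed walk from x to y (existence of a walk = existence of a path)
data Reach (D : Digraph) : DV D → DV D → Set where
  here : ∀ {x} → Reach D x x
  step : ∀ {x y} (a : A D) → proj₁ (arc D a) ≡ x →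
         Reach D (proj₂ (arc D a)) y → Reach D x y

StronglyConnected : Digraph → Set
StronglyConnected D = ∀ (x y : DV D) → Reach D x y

Orientation : Graph → Set
Orientation G = E G → Bool

orientEdge : ∀ {X : Set} → Bool → X × X → X × X
orientEdge true  (u , v) = (u , v)
orientEdge false (u , v) = (v , u)

deleteArc : (G : Graph) → Orientation G → E G → Digraph
deleteArc G O e = record
  { DV  = V G
  ; A   = Σ (E G) (λ f → ¬ (f ≡ e))
  ; arc = λ p → orientEdge (O (proj₁ p)) (ends G (proj₁ p))
  }

Deletable : (G : Graph) → Orientation G → E G → Set
Deletable G O e = StronglyConnected (deleteArc G O e)

CoveringFamily : (G : Graph) → ℕ → Set
CoveringFamily G k =
  Σ (Fin k → Orientation G) λ O → ∀ (e : E G) → ∃ λ (i : Fin k) → Deletable G (O i) e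

FrankNumber : Graph → ℕ → Set
FrankNumber G k = CoveringFamily G k × (∀ j → j < k → ¬ CoveringFamily G j)

-- Generalized Petersen graph GP(n , k), for n ≥ 1 (NonZero n).
-- Indices 0..n-1 (instead of 1..n), taken mod n.
-- Vertices: (outer , i) = u_i, (inner , i) = v_i.

data Side : Set where
  outer inner : Side

data EdgeKind : Set where
  rim spoke innerE : EdgeKind

plusMod : (n : ℕ) → .{{_ : NonZero n}} → Fin n → ℕ → Fin n
plusMod n i d = (toℕ i + d) mod n

GP : (n : ℕ) → .{{_ : NonZero n}} → ℕ → Graph
GP n k = record
  { V    = Side × Fin n
  ; E    = EdgeKind × Fin n
  ; ends = gpEnds
  }
  where
  gpEnds : EdgeKind × Fin n → (Side × Fin n) × (Side × Fin n)
  gpEnds (rim    , i) = (outer , i) , (outer , plusMod n i 1)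
  gpEnds (spoke  , i) = (outer , i) , (inner , i)
  gpEnds (innerE , i) = (inner , i) , (inner , plusMod n i k)

module Submission where

-- Lower bound: at a vertex x of degree three some incident edge e has the other two pointing the
-- same way, so x is a source or a sink of O − e; hence no single orientation makes every edge
-- deletable.  Upper bound: two explicit orientations O₁, O₂ of GP(2s+1, s), drawn as a ladder.  In
-- each of them the arcs of a fixed set of "core" edges already form a strongly connected spanning
-- subdigraph, so every edge outside the core is deletable; each remaining edge e is deletable in
-- O₁ or O₂ because that orientation minus e still has a path from the tail of e to its head.

open import Defs
open import Data.Nat using (ℕ; zero; suc; _+_; _*_; _∸_; _≤_; _<_; z≤n; s≤s)
open import Data.Nat.Properties
open import Data.Nat.DivMod using (_mod_; _%_; m%n<n; m<n⇒m%n≡m; %-distribˡ-+; m%n%n≡m%n; [m+n]%n≡m%n)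
open import Data.Fin using (Fin; toℕ) renaming (zero to fzero; suc to fsuc)
open import Data.Fin.Properties using (toℕ-fromℕ<; toℕ-injective; toℕ<n)
import Data.Fin.Properties as Fin
open import Data.Bool using (Bool; true; false; not; if_then_else_; _∨_)
open import Data.Bool.Properties using (not-injective; not-involutive)
open import Function using (_∘_)
open import Data.Product using (Σ; ∃; _×_; _,_; proj₁; proj₂)
open import Data.Product.Properties using (≡-dec)
open import Data.Sum using (_⊎_; inj₁; inj₂)
open import Relation.Nullary using (¬_; yes; no; does; contradiction)
open import Relation.Nullary.Decidable using (dec-true; dec-false)
open import Relation.Binary.Definitions using (DecidableEquality)
open import Relation.Binary.PropositionalEquality

module _ {D : Digraph} where

  reach-trans : ∀ {x y z} → Reach D x y → Reach D y z → Reach D x z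
  reach-trans here q = q
  reach-trans (step a p r) q = step a p (reach-trans r q)

  stronglyConnected-via : (h : DV D) → (∀ x → Reach D x h) → (∀ x → Reach D h x) →
                          StronglyConnected D
  stronglyConnected-via h to from x y = reach-trans (to x) (from y)

  reach-chain : (v : ℕ → DV D) (Ok : ℕ → Set) →
                (∀ t {z} → Ok t → Reach D (v (suc t)) z → Reach D (v t) z) →
                ∀ {x y} → x ≤ y → (∀ t → x ≤ t → t < y → Ok t) → Reach D (v x) (v y)
  reach-chain v Ok go {y = zero} z≤n ok = here
  reach-chain v Ok go {x} {suc y} x≤1+y ok with m≤n⇒m<n∨m≡n x≤1+y
  ... | inj₂ refl = here
  ... | inj₁ (s≤s x≤y) =
    reach-trans (reach-chain v Ok go x≤y (λ t x≤t t<y → ok t x≤t (m≤n⇒m≤1+n t<y)))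
                (go y (ok y x≤y ≤-refl) here)

Incident : (G : Graph) → V G → E G → Set
Incident G x f = proj₁ (ends G f) ≡ x ⊎ proj₂ (ends G f) ≡ x

module _ (G : Graph) (O : Orientation G) where

  oriented : Digraph
  oriented = record { DV = V G ; A = E G ; arc = λ f → orientEdge (O f) (ends G f) }

  tail head : E G → V G
  tail f = proj₁ (orientEdge (O f) (ends G f))
  head f = proj₂ (orientEdge (O f) (ends G f))

  Arc : E G → V G → V G → Set
  Arc f x y = orientEdge (O f) (ends G f) ≡ (x , y)

  arc-forward : ∀ {f x y} → O f ≡ true → ends G f ≡ (x , y) → Arc f x y
  arc-forward {f} p q rewrite p = q

  arc-backward : ∀ {f x y} → O f ≡ false → ends G f ≡ (y , x) → Arc f x y
  arc-backward {f} p q rewrite p | q = refl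

  module _ (e : E G) where

    arc-step : ∀ {x y z} f → f ≢ e → Arc f x y →
               Reach (deleteArc G O e) y z → Reach (deleteArc G O e) x z
    arc-step f f≢e refl r = step (f , f≢e) refl r

    forward-step : ∀ {f x y z} → O f ≡ true → ends G f ≡ (x , y) → f ≢ e →
                   Reach (deleteArc G O e) y z → Reach (deleteArc G O e) x z
    forward-step {f} o ends≡ f≢e = arc-step f f≢e (arc-forward o ends≡)

    backward-step : ∀ {f x y z} → O f ≡ false → ends G f ≡ (x , y) → f ≢ e →
                    Reach (deleteArc G O e) x z → Reach (deleteArc G O e) y z
    backward-step {f} o ends≡ f≢e = arc-step f f≢e (arc-backward o ends≡)

    reach-with : ∀ {x y} → Reach (deleteArc G O e) x y → Reach oriented x y
    reach-with here = here
    reach-with (step (f , _) p r) = step f p (reach-with r)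

    reach-without : DecidableEquality (E G) →
                    Reach (deleteArc G O e) (tail e) (head e) →
                    ∀ {x y} → Reach oriented x y → Reach (deleteArc G O e) x y
    reach-without _≟_ bypass here = here
    reach-without _≟_ bypass (step f p r) with f ≟ e
    ... | no f≢e = step (f , f≢e) p (reach-without _≟_ bypass r)
    ... | yes refl = reach-trans (subst (λ w → Reach _ w _) p bypass)
                                 (reach-without _≟_ bypass r)

    deletable-by-bypass : DecidableEquality (E G) → StronglyConnected oriented →
                          ∀ {x y} → Arc e x y → Reach (deleteArc G O e) x y →
                          Deletable G O e
    deletable-by-bypass _≟_ sc refl bypass u v = reach-without _≟_ bypass (sc u v)

    stronglyConnected-if-deletable : Deletable G O e → StronglyConnected oriented
    stronglyConnected-if-deletable del u v = reach-with (del u v)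

    reach-from-source : ∀ {x} → (∀ f → f ≢ e → tail f ≢ x) →
                        ∀ {y} → Reach (deleteArc G O e) x y → x ≡ y
    reach-from-source no-out here = refl
    reach-from-source no-out (step (f , f≢e) p r) = contradiction p (no-out f f≢e)

    reach-to-sink : ∀ {x} → (∀ f → f ≢ e → head f ≢ x) →
                    ∀ {y} → Reach (deleteArc G O e) y x → y ≡ x
    reach-to-sink no-in here = refl
    reach-to-sink no-in (step (f , f≢e) refl r) with reach-to-sink no-in r
    ... | refl = contradiction refl (no-in f f≢e)

  tail-incident : ∀ f → Incident G (tail f) f
  tail-incident f with O f
  ... | true  = inj₁ refl
  ... | false = inj₂ refl

  head-incident : ∀ f → Incident G (head f) f
  head-incident f with O f
  ... | true  = inj₂ refl
  ... | false = inj₁ refl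

  data Direction (x : V G) (f : E G) : Set where
    outward : head f ≢ x → Direction x f
    inward  : tail f ≢ x → Direction x f

  head≢ : ∀ {f x y} → y ≢ x → Arc f x y → head f ≢ x
  head≢ y≢x arc h = y≢x (trans (sym (cong proj₂ arc)) h)

  tail≢ : ∀ {f x y} → y ≢ x → Arc f y x → tail f ≢ x
  tail≢ y≢x arc t = y≢x (trans (sym (cong proj₁ arc)) t)

  direction : ∀ {x y f} → y ≢ x → ends G f ≡ (x , y) ⊎ ends G f ≡ (y , x) → Direction x f
  direction {f = f} y≢x ends≡ with O f in o | ends≡
  ... | true  | inj₁ e = outward (head≢ y≢x (arc-forward o e))
  ... | false | inj₁ e = inward  (tail≢ y≢x (arc-backward o e))
  ... | true  | inj₂ e = inward  (tail≢ y≢x (arc-forward o e))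
  ... | false | inj₂ e = outward (head≢ y≢x (arc-backward o e))

  module _ {x y : V G} {f₁ f₂ f₃ : E G} (y≢x : y ≢ x)
           (incident : ∀ f → Incident G x f → f ≡ f₁ ⊎ f ≡ f₂ ⊎ f ≡ f₃) where

    private
      except : ∀ {P : E G → Set} e → (f₁ ≢ e → P f₁) → (f₂ ≢ e → P f₂) → (f₃ ≢ e → P f₃) →
               ∀ f → f ≢ e → Incident G x f → P f
      except e p₁ p₂ p₃ f f≢e inc with incident f inc
      ... | inj₁ refl = p₁ f≢e
      ... | inj₂ (inj₁ refl) = p₂ f≢e
      ... | inj₂ (inj₂ refl) = p₃ f≢e

      ¬deletable-source : ∀ e → (∀ f → f ≢ e → Incident G x f → head f ≢ x) → ¬ Deletable G O e
      ¬deletable-source e out del = y≢x (reach-to-sink e no-in (del y x))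
        where
        no-in : ∀ f → f ≢ e → head f ≢ x
        no-in f f≢e hd = out f f≢e (subst (λ v → Incident G v f) hd (head-incident f)) hd

      ¬deletable-sink : ∀ e → (∀ f → f ≢ e → Incident G x f → tail f ≢ x) → ¬ Deletable G O e
      ¬deletable-sink e inn del = y≢x (sym (reach-from-source e no-out (del x y)))
        where
        no-out : ∀ f → f ≢ e → tail f ≢ x
        no-out f f≢e tl = inn f f≢e (subst (λ v → Incident G v f) tl (tail-incident f)) tl

    degree-three⇒¬all-deletable : Direction x f₁ → Direction x f₂ → Direction x f₃ →
                                  ¬ (∀ e → Deletable G O e)
    degree-three⇒¬all-deletable _ (outward h₂) (outward h₃) all =
      ¬deletable-source f₁ (except f₁ (contradiction refl) (λ _ → h₂) (λ _ → h₃)) (all f₁)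
    degree-three⇒¬all-deletable _ (inward t₂) (inward t₃) all =
      ¬deletable-sink f₁ (except f₁ (contradiction refl) (λ _ → t₂) (λ _ → t₃)) (all f₁)
    degree-three⇒¬all-deletable (outward h₁) (outward h₂) (inward _) all =
      ¬deletable-source f₃ (except f₃ (λ _ → h₁) (λ _ → h₂) (contradiction refl)) (all f₃)
    degree-three⇒¬all-deletable (inward t₁) (inward t₂) (outward _) all =
      ¬deletable-sink f₃ (except f₃ (λ _ → t₁) (λ _ → t₂) (contradiction refl)) (all f₃)
    degree-three⇒¬all-deletable (outward h₁) (inward _) (outward h₃) all =
      ¬deletable-source f₂ (except f₂ (λ _ → h₁) (contradiction refl) (λ _ → h₃)) (all f₂)
    degree-three⇒¬all-deletable (inward t₁) (outward _) (inward t₃) all =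
      ¬deletable-sink f₂ (except f₂ (λ _ → t₁) (contradiction refl) (λ _ → t₃)) (all f₂)

frankNumber-two : (G : Graph) → E G → (∀ O → ¬ (∀ e → Deletable G O e)) →
                  CoveringFamily G 2 → FrankNumber G 2
frankNumber-two G e ¬all cover = cover , no-smaller
  where
  no-smaller : ∀ j → j < 2 → ¬ CoveringFamily G j
  no-smaller 0 _ (O , covers) with () ← proj₁ (covers e)
  no-smaller 1 _ (O , covers) = ¬all (O fzero) only
    where
    only : ∀ f → Deletable G (O fzero) f
    only f with covers f
    ... | fzero , d = d
  no-smaller (suc (suc _)) (s≤s (s≤s ()))

module Ladder (r : ℕ) where

  s n : ℕ
  s = 3 + r
  n = suc (2 * s)

  G : Graph
  G = GP n s

  idx : ℕ → Fin n
  idx m = m mod n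

  toℕ-idx : ∀ m → toℕ (idx m) ≡ m % n
  toℕ-idx m = toℕ-fromℕ< (m%n<n m n)

  toℕ-idx-< : ∀ {m} → m < n → toℕ (idx m) ≡ m
  toℕ-idx-< {m} m<n = trans (toℕ-idx m) (m<n⇒m%n≡m m<n)

  idx-toℕ : (i : Fin n) → idx (toℕ i) ≡ i
  idx-toℕ i = toℕ-injective (toℕ-idx-< (toℕ<n i))

  idx-% : ∀ m m′ → m % n ≡ m′ % n → idx m ≡ idx m′
  idx-% m m′ eq = toℕ-injective (trans (toℕ-idx m) (trans eq (sym (toℕ-idx m′))))

  plusMod-idx : ∀ m d → plusMod n (idx m) d ≡ idx (m + d)
  plusMod-idx m d = idx-% (toℕ (idx m) + d) (m + d) (begin
    (toℕ (idx m) + d) % n    ≡⟨ cong (λ w → (w + d) % n) (toℕ-idx m) ⟩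
    (m % n + d) % n          ≡⟨ %-distribˡ-+ (m % n) d n ⟩
    (m % n % n + d % n) % n  ≡⟨ cong (λ w → (w + d % n) % n) (m%n%n≡m%n m n) ⟩
    (m % n + d % n) % n      ≡⟨ %-distribˡ-+ m d n ⟨
    (m + d) % n              ∎)
    where open ≡-Reasoning

  idx-+n : ∀ m → idx (m + n) ≡ idx m
  idx-+n m = idx-% (m + n) m ([m+n]%n≡m%n m n)

  n≡1+s+s : n ≡ suc (s + s)
  n≡1+s+s = cong (λ w → suc (s + w)) (+-identityʳ s)

  low<n : ∀ {t} → t ≤ s → t < n
  low<n {t} t≤s = subst (t <_) (sym n≡1+s+s) (s≤s (≤-trans t≤s (m≤m+n s s)))

  high<n : ∀ {t} → t < s → suc (t + s) < n
  high<n {t} t<s = subst (suc (t + s) <_) (sym n≡1+s+s) (s≤s (+-monoˡ-≤ s t<s))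

  high-index : ∀ {j} → j < n → ¬ (j ≤ s) → Σ ℕ λ t → t < s × suc (t + s) ≡ j
  high-index {j} j<n j≰s = j ∸ suc s , t<s , 1+t+s≡j
    where
    1+t+s≡j : suc (j ∸ suc s + s) ≡ j
    1+t+s≡j = trans (sym (+-suc (j ∸ suc s) s)) (m∸n+n≡m (≰⇒> j≰s))
    t<s : j ∸ suc s < s
    t<s = +-cancelʳ-≤ s (suc (j ∸ suc s)) s
            (subst (_≤ s + s) (sym 1+t+s≡j) (≤-pred (subst (j <_) n≡1+s+s j<n)))

  t+s≮s : ∀ t → ¬ (t + s < s)
  t+s≮s t lt = <⇒≱ lt (m≤n+m s t)

  high≰s : ∀ t → ¬ (suc (t + s) ≤ s)
  high≰s t le = 1+n≰n (≤-trans (s≤s (m≤n+m s t)) le)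

  low≢high : ∀ {j} → j ≤ s → ∀ t → j ≢ suc (t + s)
  low≢high j≤s t refl = high≰s t j≤s

  s-1 : ℕ
  s-1 = 2 + r

  s-1<s : s-1 < s
  s-1<s = ≤-refl

  0<s : 0 < s
  0<s = s≤s z≤n

  1<s : 1 < s
  1<s = s≤s (s≤s z≤n)

  2<s : 2 < s
  2<s = s≤s (s≤s (s≤s z≤n))

  -- The outer cycle is a 0 … a s c 0 … c (s-1) a 0 (c s = a 0), the
  -- inner one b 0 d 0 b 1 d 1 … d (s-1) b s b 0; K t = v_{t+1} v_{t+s+1} and H t = v_{t+s+1} v_{t+2s+1}.
  a b c d : ℕ → V G
  a t = outer , idx t
  b t = inner , idx t
  c t = outer , idx (suc (t + s))
  d t = inner , idx (suc (t + s))

  L R P Q K H : ℕ → E G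
  L t = rim , idx t
  R t = rim , idx (suc (t + s))
  P t = spoke , idx t
  Q t = spoke , idx (suc (t + s))
  K t = innerE , idx (suc t)
  H t = innerE , idx (suc (t + s))

  W X : E G
  W = innerE , idx 0
  X = L s

  c-s≡a-0 : c s ≡ a 0
  c-s≡a-0 = cong (outer ,_) (trans (cong idx (sym n≡1+s+s)) (idx-+n 0))

  plusMod-1 : ∀ m → plusMod n (idx m) 1 ≡ idx (suc m)
  plusMod-1 m = trans (plusMod-idx m 1) (cong idx (+-comm m 1))

  plusMod-s-high : ∀ t → plusMod n (idx (suc (t + s))) s ≡ idx t
  plusMod-s-high t = trans (plusMod-idx (suc (t + s)) s) (trans (cong idx t+n) (idx-+n t))
    where
    t+n : suc (t + s) + s ≡ t + n
    t+n = begin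
      suc (t + s + s)    ≡⟨ cong suc (+-assoc t s s) ⟩
      suc (t + (s + s))  ≡⟨ +-suc t (s + s) ⟨
      t + suc (s + s)    ≡⟨ cong (t +_) n≡1+s+s ⟨
      t + n              ∎
      where open ≡-Reasoning

  ends-L : ∀ t → ends G (L t) ≡ (a t , a (suc t))
  ends-L t = cong (λ w → a t , (outer , w)) (plusMod-1 t)

  ends-R : ∀ t → ends G (R t) ≡ (c t , c (suc t))
  ends-R t = cong (λ w → c t , (outer , w)) (plusMod-1 (suc (t + s)))

  ends-R-last : ends G (R s-1) ≡ (c s-1 , a 0)
  ends-R-last = trans (ends-R s-1) (cong (c s-1 ,_) c-s≡a-0)

  ends-P : ∀ t → ends G (P t) ≡ (a t , b t)
  ends-P t = refl

  ends-Q : ∀ t → ends G (Q t) ≡ (c t , d t)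
  ends-Q t = refl

  ends-K : ∀ t → ends G (K t) ≡ (b (suc t) , d t)
  ends-K t = cong (λ w → b (suc t) , (inner , w)) (plusMod-idx (suc t) s)

  ends-H : ∀ t → ends G (H t) ≡ (d t , b t)
  ends-H t = cong (λ w → d t , (inner , w)) (plusMod-s-high t)

  ends-W : ends G W ≡ (b 0 , b s)
  ends-W = cong (λ w → b 0 , (inner , w)) (plusMod-idx 0 s)

  vertex-cases : (Φ : V G → Set) →
                 (∀ t → t ≤ s → Φ (a t)) → (∀ t → t < s → Φ (c t)) →
                 (∀ t → t ≤ s → Φ (b t)) → (∀ t → t < s → Φ (d t)) → ∀ x → Φ x
  vertex-cases Φ φa φc φb φd (side , i) =
    subst (λ w → Φ (side , w)) (idx-toℕ i) (at side (toℕ i) (toℕ<n i))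
    where
    at : ∀ side j → j < n → Φ (side , idx j)
    at side j j<n with j ≤? s
    at outer j j<n | yes j≤s = φa j j≤s
    at inner j j<n | yes j≤s = φb j j≤s
    at side  j j<n | no j≰s with high-index j<n j≰s
    at outer j j<n | no j≰s | t , t<s , refl = φc t t<s
    at inner j j<n | no j≰s | t , t<s , refl = φd t t<s

  edge-cases : (Ψ : E G → Set) →
               (∀ t → t ≤ s → Ψ (L t)) → (∀ t → t < s → Ψ (R t)) →
               (∀ t → t ≤ s → Ψ (P t)) → (∀ t → t < s → Ψ (Q t)) →
               Ψ W → (∀ t → t < s → Ψ (K t)) → (∀ t → t < s → Ψ (H t)) → ∀ f → Ψ f
  edge-cases Ψ ψL ψR ψP ψQ ψW ψK ψH (kind , i) =
    subst (λ w → Ψ (kind , w)) (idx-toℕ i) (at kind (toℕ i) (toℕ<n i))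
    where
    at : ∀ kind j → j < n → Ψ (kind , idx j)
    at kind j j<n with j ≤? s
    at rim    j       j<n | yes j≤s = ψL j j≤s
    at spoke  j       j<n | yes j≤s = ψP j j≤s
    at innerE zero    j<n | yes j≤s = ψW
    at innerE (suc j) j<n | yes j≤s = ψK j j≤s
    at kind   j j<n | no j≰s with high-index j<n j≰s
    at rim    j j<n | no j≰s | t , t<s , refl = ψR t t<s
    at spoke  j j<n | no j≰s | t , t<s , refl = ψQ t t<s
    at innerE j j<n | no j≰s | t , t<s , refl = ψH t t<s

  kind≢ : ∀ {k k′ : EdgeKind} {i i′ : Fin n} → k ≢ k′ → (k , i) ≢ (k′ , i′)
  kind≢ k≢k′ refl = k≢k′ refl

  idx-injective : ∀ {A : Set} {x x′ : A} {j j′} → j < n → j′ < n →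
                  (x , idx j) ≡ (x′ , idx j′) → j ≡ j′
  idx-injective j<n j′<n eq =
    trans (sym (toℕ-idx-< j<n)) (trans (cong (λ p → toℕ (proj₂ p)) eq) (toℕ-idx-< j′<n))

  index≢ : ∀ {A : Set} {x x′ : A} {j j′} → j < n → j′ < n → j ≢ j′ → (x , idx j) ≢ (x′ , idx j′)
  index≢ j<n j′<n j≢j′ = j≢j′ ∘ idx-injective j<n j′<n

  _≟ₖ_ : DecidableEquality EdgeKind
  rim    ≟ₖ rim    = yes refl
  spoke  ≟ₖ spoke  = yes refl
  innerE ≟ₖ innerE = yes refl
  rim    ≟ₖ spoke  = no λ ()
  rim    ≟ₖ innerE = no λ ()
  spoke  ≟ₖ rim    = no λ ()
  spoke  ≟ₖ innerE = no λ ()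
  innerE ≟ₖ rim    = no λ ()
  innerE ≟ₖ spoke  = no λ ()

  _≟ₑ_ : DecidableEquality (E G)
  _≟ₑ_ = ≡-dec _≟ₖ_ Fin._≟_

  onIndex : (EdgeKind → ℕ → Bool) → Orientation G
  onIndex o (k , i) = o k (toℕ i)

  onIndex-idx : ∀ o k {j} → j < n → onIndex o (k , idx j) ≡ o k j
  onIndex-idx o k j<n = cong (o k) (toℕ-idx-< j<n)

  even : ℕ → Bool
  even zero    = true
  even (suc t) = not (even t)

  parity : ∀ t → even t ≡ true ⊎ even t ≡ false
  parity t with even t
  ... | true  = inj₁ refl
  ... | false = inj₂ refl

  even⇒≢1 : ∀ {t} → even t ≡ true → t ≢ 1
  even⇒≢1 () refl

  odd-suc⇒even : ∀ t → even (suc t) ≡ false → even t ≡ true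
  odd-suc⇒even t = not-injective

  even-+2 : ∀ t → even (suc (suc t)) ≡ even t
  even-+2 t = not-involutive (even t)

  even-s-1 : even s-1 ≡ even r
  even-s-1 = even-+2 r

  even-s : even s ≡ not (even r)
  even-s = cong not even-s-1

module First (r : ℕ) where

  open Ladder r

  q : ℕ → Bool
  q zero            = false
  q (suc zero)      = true
  q t@(suc (suc _)) = even t

  o : EdgeKind → ℕ → Bool
  o rim    j       = if does (j <? s) then not (even j) else true
  o spoke  j       = if does (j ≤? s) then even j else q (j ∸ suc s)
  o innerE zero    = false
  o innerE (suc j) = if does (j <? s) then even (suc j) else does (j ∸ s ≟ 1)

  O : Orientation G
  O = onIndex o

  O-L : ∀ {t} → t < s → O (L t) ≡ not (even t)
  O-L {t} t<s rewrite onIndex-idx o rim (low<n (<⇒≤ t<s)) | dec-true (t <? s) t<s = refl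

  O-X : O X ≡ true
  O-X rewrite onIndex-idx o rim (low<n ≤-refl) | dec-false (s <? s) (n≮n s) = refl

  O-R : ∀ {t} → t < s → O (R t) ≡ true
  O-R {t} t<s rewrite onIndex-idx o rim (high<n t<s)
                    | dec-false (suc (t + s) <? s) (high≰s t ∘ <⇒≤) = refl

  O-P : ∀ {t} → t ≤ s → O (P t) ≡ even t
  O-P {t} t≤s rewrite onIndex-idx o spoke (low<n t≤s) | dec-true (t ≤? s) t≤s = refl

  O-Q : ∀ {t} → t < s → O (Q t) ≡ q t
  O-Q {t} t<s rewrite onIndex-idx o spoke (high<n t<s)
                    | dec-false (suc (t + s) ≤? s) (high≰s t) | m+n∸n≡m t s = refl

  O-K : ∀ {t} → t < s → O (K t) ≡ even (suc t)
  O-K {t} t<s rewrite onIndex-idx o innerE (low<n t<s) | dec-true (t <? s) t<s = refl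

  O-H : ∀ {t} → t < s → O (H t) ≡ does (t ≟ 1)
  O-H {t} t<s rewrite onIndex-idx o innerE (high<n t<s)
                    | dec-false (t + s <? s) (t+s≮s t) | m+n∸n≡m t s = refl

  O-W : O W ≡ false
  O-W rewrite onIndex-idx o innerE {0} (s≤s z≤n) = refl

  core-o : EdgeKind → ℕ → Bool
  core-o rim            = o rim
  core-o spoke  j       = if does (j ≤? s) then true else not (even (j ∸ suc s))
  core-o innerE zero    = true
  core-o innerE (suc j) = if does (j <? s) then not (even (suc j)) else true

  core : E G → Bool
  core = onIndex core-o

  core-P : ∀ {t} → t ≤ s → core (P t) ≡ true
  core-P {t} t≤s rewrite onIndex-idx core-o spoke (low<n t≤s) | dec-true (t ≤? s) t≤s = refl

  core-Q : ∀ {t} → t < s → core (Q t) ≡ not (even t)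
  core-Q {t} t<s rewrite onIndex-idx core-o spoke (high<n t<s)
                       | dec-false (suc (t + s) ≤? s) (high≰s t) | m+n∸n≡m t s = refl

  core-K : ∀ {t} → t < s → core (K t) ≡ not (even (suc t))
  core-K {t} t<s rewrite onIndex-idx core-o innerE (low<n t<s) | dec-true (t <? s) t<s = refl

  core-H : ∀ {t} → t < s → core (H t) ≡ true
  core-H {t} t<s rewrite onIndex-idx core-o innerE (high<n t<s)
                       | dec-false (t + s <? s) (t+s≮s t) = refl

  core-W : core W ≡ true
  core-W rewrite onIndex-idx core-o innerE {0} (s≤s z≤n) = refl

  -- f⁺ (f⁻) prepends the arc of f, traversed from the first (second) vertex of ends G f, to a walk
  -- of O − e; its hypotheses say that O orients f that way and that f ≢ e.
  module Steps (e : E G) where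

    D : Digraph
    D = deleteArc G O e

    L⁺ : ∀ {t z} → t < s → even t ≡ false → L t ≢ e → Reach D (a (suc t)) z → Reach D (a t) z
    L⁺ {t} t<s ev = forward-step G O e (trans (O-L t<s) (cong not ev)) (ends-L t)

    L⁻ : ∀ {t z} → t < s → even t ≡ true → L t ≢ e → Reach D (a t) z → Reach D (a (suc t)) z
    L⁻ {t} t<s ev = backward-step G O e (trans (O-L t<s) (cong not ev)) (ends-L t)

    X⁺ : ∀ {z} → X ≢ e → Reach D (c 0) z → Reach D (a s) z
    X⁺ = forward-step G O e O-X (ends-L s)

    R⁺ : ∀ {t z} → t < s → R t ≢ e → Reach D (c (suc t)) z → Reach D (c t) z
    R⁺ {t} t<s = forward-step G O e (O-R t<s) (ends-R t)

    P⁺ : ∀ {t z} → t ≤ s → even t ≡ true → P t ≢ e → Reach D (b t) z → Reach D (a t) z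
    P⁺ {t} t≤s ev = forward-step G O e (trans (O-P t≤s) ev) (ends-P t)

    P⁻ : ∀ {t z} → t ≤ s → even t ≡ false → P t ≢ e → Reach D (a t) z → Reach D (b t) z
    P⁻ {t} t≤s ev = backward-step G O e (trans (O-P t≤s) ev) (ends-P t)

    Q⁺ : ∀ {t z} → t < s → q t ≡ true → Q t ≢ e → Reach D (d t) z → Reach D (c t) z
    Q⁺ {t} t<s qt = forward-step G O e (trans (O-Q t<s) qt) (ends-Q t)

    Q⁻ : ∀ {t z} → t < s → q t ≡ false → Q t ≢ e → Reach D (c t) z → Reach D (d t) z
    Q⁻ {t} t<s qt = backward-step G O e (trans (O-Q t<s) qt) (ends-Q t)

    K⁺ : ∀ {t z} → t < s → even (suc t) ≡ true → K t ≢ e → Reach D (d t) z → Reach D (b (suc t)) z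
    K⁺ {t} t<s ev = forward-step G O e (trans (O-K t<s) ev) (ends-K t)

    K⁻ : ∀ {t z} → t < s → even (suc t) ≡ false → K t ≢ e → Reach D (b (suc t)) z → Reach D (d t) z
    K⁻ {t} t<s ev = backward-step G O e (trans (O-K t<s) ev) (ends-K t)

    H⁺ : ∀ {z} → H 1 ≢ e → Reach D (b 1) z → Reach D (d 1) z
    H⁺ = forward-step G O e (O-H 1<s) (ends-H 1)

    H⁻ : ∀ {t z} → t < s → t ≢ 1 → H t ≢ e → Reach D (d t) z → Reach D (b t) z
    H⁻ {t} t<s t≢1 = backward-step G O e (trans (O-H t<s) (dec-false (t ≟ 1) t≢1)) (ends-H t)

    W⁻ : ∀ {z} → W ≢ e → Reach D (b 0) z → Reach D (b s) z
    W⁻ = backward-step G O e O-W ends-W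

    to-a0 : ∀ {x} → Reach D x (c s) → Reach D x (a 0)
    to-a0 = subst (Reach D _) c-s≡a-0

    R-chain : ∀ {x y} → x ≤ y → y ≤ s → (∀ t → x ≤ t → t < y → R t ≢ e) → Reach D (c x) (c y)
    R-chain x≤y y≤s R≢ = reach-chain c (λ t → t < s × R t ≢ e) (λ t (t<s , R≢e) → R⁺ t<s R≢e) x≤y
                                     (λ t x≤t t<y → ≤-trans t<y y≤s , R≢ t x≤t t<y)

    -- a t reaches a (t+1) along L t for odd t, and along a t b t d t b (t+1) a (t+1) for even t.
    record Rung (t : ℕ) : Set where
      field
        L≢ : even t ≡ false → L t ≢ e
        P≢ : P t ≢ e
        H≢ : H t ≢ e
        K≢ : even t ≡ true → K t ≢ e
        P′≢ : P (suc t) ≢ e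

    climb : ∀ t {z} → t < s → Rung t → Reach D (a (suc t)) z → Reach D (a t) z
    climb t t<s rung with parity t
    ... | inj₂ odd = L⁺ t<s odd (Rung.L≢ rung odd)
    ... | inj₁ ev  = P⁺ (<⇒≤ t<s) ev (Rung.P≢ rung) ∘ H⁻ t<s (even⇒≢1 ev) (Rung.H≢ rung)
                   ∘ K⁻ t<s (cong not ev) (Rung.K≢ rung ev) ∘ P⁻ t<s (cong not ev) (Rung.P′≢ rung)

    a-chain : ∀ {x y} → x ≤ y → y ≤ s → (∀ t → x ≤ t → t < y → Rung t) → Reach D (a x) (a y)
    a-chain x≤y y≤s rung = reach-chain a (λ t → t < s × Rung t) (λ t (t<s , rt) → climb t t<s rt) x≤y
                                       (λ t x≤t t<y → ≤-trans t<y y≤s , rung t x≤t t<y)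

  module Core (e : E G) (e∉core : core e ≡ false) where

    open Steps e

    core≢ : ∀ {f} → core f ≡ true → f ≢ e
    core≢ f∈core refl = contradiction (trans (sym f∈core) e∉core) λ ()

    P≢ : ∀ {t} → t ≤ s → P t ≢ e
    P≢ = core≢ ∘ core-P

    H≢ : ∀ {t} → t < s → H t ≢ e
    H≢ = core≢ ∘ core-H

    K≢ : ∀ {t} → t < s → even (suc t) ≡ false → K t ≢ e
    K≢ t<s odd = core≢ (trans (core-K t<s) (cong not odd))

    rung : ∀ t → t < s → Rung t
    rung t t<s = record
      { L≢  = λ odd → core≢ (trans (O-L t<s) (cong not odd))
      ; P≢  = P≢ (<⇒≤ t<s)
      ; H≢  = H≢ t<s
      ; K≢  = K≢ t<s ∘ cong not
      ; P′≢ = P≢ t<s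
      }

    a→ : ∀ {x y} → x ≤ y → y ≤ s → Reach D (a x) (a y)
    a→ x≤y y≤s = a-chain x≤y y≤s (λ t _ t<y → rung t (≤-trans t<y y≤s))

    c→ : ∀ {x y} → x ≤ y → y ≤ s → Reach D (c x) (c y)
    c→ x≤y y≤s = R-chain x≤y y≤s (λ t _ t<y → core≢ (O-R (≤-trans t<y y≤s)))

    a-s→hub : Reach D (a s) (a 0)
    a-s→hub = X⁺ (core≢ O-X) (to-a0 (c→ z≤n ≤-refl))

    a→hub : ∀ t → t ≤ s → Reach D (a t) (a 0)
    a→hub t t≤s = reach-trans (a→ t≤s ≤-refl) a-s→hub

    hub→a : ∀ t → t ≤ s → Reach D (a 0) (a t)
    hub→a t t≤s = a→ z≤n t≤s

    c→hub : ∀ t → t < s → Reach D (c t) (a 0)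
    c→hub t t<s = to-a0 (c→ (<⇒≤ t<s) ≤-refl)

    hub→c : ∀ t → t < s → Reach D (a 0) (c t)
    hub→c t t<s = reach-trans (a→ z≤n ≤-refl) (X⁺ (core≢ O-X) (c→ z≤n (<⇒≤ t<s)))

    b→hub-even : ∀ t → t < s → even t ≡ true → Reach D (b t) (a 0)
    b→hub-even t t<s ev =
      H⁻ t<s (even⇒≢1 ev) (H≢ t<s) (K⁻ t<s (cong not ev) (K≢ t<s (cong not ev))
        (P⁻ t<s (cong not ev) (P≢ t<s) (a→hub (suc t) t<s)))

    b→hub : ∀ t → t ≤ s → Reach D (b t) (a 0)
    b→hub t t≤s with parity t
    ... | inj₂ odd = P⁻ t≤s odd (P≢ t≤s) (a→hub t t≤s)
    ... | inj₁ ev with m≤n⇒m<n∨m≡n t≤s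
    ...   | inj₁ t<s  = b→hub-even t t<s ev
    ...   | inj₂ refl = W⁻ (core≢ core-W) (b→hub-even 0 0<s refl)

    hub→b : ∀ t → t ≤ s → Reach D (a 0) (b t)
    hub→b t t≤s with parity t
    hub→b t       t≤s | inj₁ ev  = reach-trans (hub→a t t≤s) (P⁺ t≤s ev (P≢ t≤s) here)
    hub→b (suc u) t<s | inj₂ odd = reach-trans (hub→a u (<⇒≤ t<s))
      (P⁺ (<⇒≤ t<s) (odd-suc⇒even u odd) (P≢ (<⇒≤ t<s))
        (H⁻ t<s (even⇒≢1 (odd-suc⇒even u odd)) (H≢ t<s) (K⁻ t<s odd (K≢ t<s odd) here)))

    d→hub : ∀ t → t < s → Reach D (d t) (a 0)
    d→hub t t<s with parity t
    d→hub t             t<s | inj₁ ev  =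
      K⁻ t<s (cong not ev) (K≢ t<s (cong not ev)) (P⁻ t<s (cong not ev) (P≢ t<s) (a→hub (suc t) t<s))
    d→hub 1             t<s | inj₂ _   =
      H⁺ (H≢ t<s) (P⁻ (<⇒≤ t<s) refl (P≢ (<⇒≤ t<s)) (a→hub 1 (<⇒≤ t<s)))
    d→hub (suc (suc u)) t<s | inj₂ odd =
      Q⁻ t<s odd (core≢ (trans (core-Q t<s) (cong not odd))) (c→hub _ t<s)

    hub→d : ∀ t → t < s → Reach D (a 0) (d t)
    hub→d t t<s with parity t
    hub→d t             t<s | inj₁ ev =
      reach-trans (hub→a t (<⇒≤ t<s))
                  (P⁺ (<⇒≤ t<s) ev (P≢ (<⇒≤ t<s)) (H⁻ t<s (even⇒≢1 ev) (H≢ t<s) here))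
    hub→d 1             t<s | inj₂ _  = reach-trans (hub→c 1 t<s) (Q⁺ t<s refl (core≢ (core-Q t<s)) here)
    hub→d (suc (suc u)) t<s | inj₂ _  = reach-trans (hub→b _ (<⇒≤ t<s)) (H⁻ t<s (λ ()) (H≢ t<s) here)

    stronglyConnected-minus : StronglyConnected D
    stronglyConnected-minus = stronglyConnected-via (a 0)
      (vertex-cases (λ x → Reach D x (a 0)) a→hub c→hub b→hub d→hub)
      (vertex-cases (λ x → Reach D (a 0) x) hub→a hub→c hub→b hub→d)

  deletable-outside-core : ∀ e → core e ≡ false → Deletable G O e
  deletable-outside-core = Core.stronglyConnected-minus

  stronglyConnected : StronglyConnected (oriented G O)
  stronglyConnected = stronglyConnected-if-deletable G O (L 0) (deletable-outside-core (L 0) (O-L 0<s))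

  deletable-forward : ∀ f {x y} → O f ≡ true → ends G f ≡ (x , y) →
                      Reach (deleteArc G O f) x y → Deletable G O f
  deletable-forward f o ends≡ =
    deletable-by-bypass G O f _≟ₑ_ stronglyConnected (arc-forward G O {f} o ends≡)

  deletable-backward : ∀ f {x y} → O f ≡ false → ends G f ≡ (y , x) →
                       Reach (deleteArc G O f) x y → Deletable G O f
  deletable-backward f o ends≡ =
    deletable-by-bypass G O f _≟ₑ_ stronglyConnected (arc-backward G O {f} o ends≡)

  deletable-L1 : Deletable G O (L 1)
  deletable-L1 = deletable-forward (L 1) (O-L 1<s) (ends-L 1)
    (L⁻ 0<s refl (index≢ (low<n z≤n) (low<n (<⇒≤ 1<s)) λ ()) (P⁺ z≤n refl (kind≢ λ ())
    (H⁻ 0<s (λ ()) (kind≢ λ ()) (Q⁻ 0<s refl (kind≢ λ ())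
    (R⁺ 0<s (index≢ (high<n 0<s) (low<n (<⇒≤ 1<s)) λ ())
    (R⁺ 1<s (index≢ (high<n 1<s) (low<n (<⇒≤ 1<s)) λ ())
    (Q⁺ 2<s refl (kind≢ λ ()) (K⁻ 2<s refl (kind≢ λ ()) (P⁻ 2<s refl (kind≢ λ ())
    (L⁻ 2<s refl (index≢ (low<n (<⇒≤ 2<s)) (low<n (<⇒≤ 1<s)) λ ()) here))))))))))
    where open Steps (L 1)

  deletable-K0 : Deletable G O (K 0)
  deletable-K0 = deletable-backward (K 0) (O-K 0<s) (ends-K 0)
    (Q⁻ 0<s refl (kind≢ λ ()) (R⁺ 0<s (kind≢ λ ()) (Q⁺ 1<s refl (kind≢ λ ())
    (H⁺ (index≢ (high<n 1<s) (low<n (<⇒≤ 1<s)) λ ()) here))))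
    where open Steps (K 0)

  deletable-Q1 : Deletable G O (Q 1)
  deletable-Q1 = deletable-forward (Q 1) (O-Q 1<s) (ends-Q 1)
    (reach-trans (to-a0 (R-chain (s≤s z≤n) ≤-refl λ _ _ _ → kind≢ λ ()))
    (P⁺ z≤n refl (index≢ (low<n z≤n) (high<n 1<s) λ ()) (H⁻ 0<s (λ ()) (kind≢ λ ())
    (K⁻ 0<s refl (kind≢ λ ()) (P⁻ (<⇒≤ 1<s) refl (index≢ (low<n (<⇒≤ 1<s)) (high<n 1<s) λ ())
    (L⁺ 1<s refl (kind≢ λ ()) (P⁺ (<⇒≤ 2<s) refl (index≢ (low<n (<⇒≤ 2<s)) (high<n 1<s) λ ())
    (K⁺ 1<s refl (kind≢ λ ()) here))))))))
    where open Steps (Q 1)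

  deletable-H2 : Deletable G O (H 2)
  deletable-H2 = deletable-backward (H 2) (O-H 2<s) (ends-H 2)
    (K⁺ 1<s refl (index≢ (low<n 1<s) (high<n 2<s) (low≢high 1<s 2))
    (H⁺ (index≢ (high<n 1<s) (high<n 2<s) λ ()) (P⁻ (<⇒≤ 1<s) refl (kind≢ λ ())
    (L⁻ 0<s refl (kind≢ λ ()) (P⁺ z≤n refl (kind≢ λ ())
    (H⁻ 0<s (λ ()) (index≢ (high<n 0<s) (high<n 2<s) λ ()) (Q⁻ 0<s refl (kind≢ λ ())
    (R⁺ 0<s (kind≢ λ ()) (R⁺ 1<s (kind≢ λ ()) (Q⁺ 2<s refl (kind≢ λ ()) here))))))))))
    where open Steps (H 2)

  deletable-R-even : ∀ u → even u ≡ true → 3 + u < s → Deletable G O (R (2 + u))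
  deletable-R-even u ev t+1<s = deletable-forward (R t) (O-R t<s) (ends-R t)
    (Q⁺ t<s even-t (kind≢ λ ()) (K⁻ t<s (cong not even-t) (kind≢ λ ())
    (H⁻ t+1<s (λ ()) (kind≢ λ ()) (Q⁻ t+1<s (cong not even-t) (kind≢ λ ()) here))))
    where
    t = 2 + u
    t<s : t < s
    t<s = <⇒≤ t+1<s
    even-t : even t ≡ true
    even-t = trans (even-+2 u) ev
    open Steps (R t)

  deletable-H-odd : ∀ u → even u ≡ false → 2 + u < s → Deletable G O (H (2 + u))
  deletable-H-odd u odd t<s = deletable-backward (H t)
    (trans (O-H t<s) (dec-false (t ≟ 1) λ ())) (ends-H t)
    (P⁻ (<⇒≤ t<s) odd-t (kind≢ λ ()) (L⁺ t<s odd-t (kind≢ λ ()) (P⁺ t<s (cong not odd-t) (kind≢ λ ())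
    (K⁺ t<s (cong not odd-t) (index≢ (low<n t<s) (high<n t<s) (low≢high t<s t)) here))))
    where
    t = 2 + u
    odd-t : even t ≡ false
    odd-t = trans (even-+2 u) odd
    open Steps (H t)

  deletable-H-even : ∀ u → even u ≡ true → 4 + u < s → Deletable G O (H (4 + u))
  deletable-H-even u ev t<s = deletable-backward (H t)
    (trans (O-H t<s) (dec-false (t ≟ 1) λ ())) (ends-H t)
    (K⁺ t-1<s (cong not odd-t-1) (index≢ (low<n (<⇒≤ t<s)) (high<n t<s) (low≢high (<⇒≤ t<s) t))
    (Q⁻ t-1<s odd-t-1 (kind≢ λ ()) (R⁺ t-1<s (kind≢ λ ()) (Q⁺ t<s (cong not odd-t-1) (kind≢ λ ()) here))))
    where
    t = 4 + u
    t-1<s : 3 + u < s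
    t-1<s = <⇒≤ t<s
    odd-t-1 : even (3 + u) ≡ false
    odd-t-1 = cong not (trans (even-+2 u) ev)
    open Steps (H t)

  deletable-X : Deletable G O X
  deletable-X with parity r
  ... | inj₂ r-odd = deletable-forward X O-X (ends-L s)
    (P⁺ ≤-refl (trans even-s (cong not r-odd)) (kind≢ λ ()) (W⁻ (kind≢ λ ())
    (H⁻ 0<s (λ ()) (kind≢ λ ()) (Q⁻ 0<s refl (kind≢ λ ()) here))))
    where open Steps X
  ... | inj₁ r-even = deletable-forward X O-X (ends-L s)
    (L⁻ s-1<s s-1-even (index≢ (low<n (<⇒≤ s-1<s)) (low<n ≤-refl) (<⇒≢ s-1<s))
    (P⁺ (<⇒≤ s-1<s) s-1-even (kind≢ λ ()) (H⁻ s-1<s (λ ()) (kind≢ λ ())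
    (K⁻ s-1<s (cong not s-1-even) (kind≢ λ ()) (W⁻ (kind≢ λ ())
    (H⁻ 0<s (λ ()) (kind≢ λ ()) (Q⁻ 0<s refl (kind≢ λ ()) here)))))))
    where
    s-1-even : even s-1 ≡ true
    s-1-even = trans even-s-1 r-even
    open Steps X

  deletable-W : Deletable G O W
  deletable-W with parity r
  ... | inj₂ r-odd = deletable-backward W O-W ends-W
    (reach-trans (to-a0 (K⁺ s-1<s (trans even-s (cong not r-odd)) (index≢ (low<n ≤-refl) (low<n z≤n) λ ())
      (Q⁻ s-1<s (trans even-s-1 r-odd) (kind≢ λ ()) (R⁺ s-1<s (kind≢ λ ()) here))))
    (P⁺ z≤n refl (kind≢ λ ()) here))
    where open Steps W
  ... | inj₁ r-even = deletable-backward W O-W ends-W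
    (P⁻ ≤-refl (trans even-s (cong not r-even)) (kind≢ λ ()) (X⁺ (kind≢ λ ())
    (reach-trans (to-a0 (R-chain z≤n ≤-refl λ _ _ _ → kind≢ λ ())) (P⁺ z≤n refl (kind≢ λ ()) here))))
    where open Steps W

  deletable-R-last : even r ≡ true → Deletable G O (R s-1)
  deletable-R-last r-even = deletable-forward (R s-1) (O-R s-1<s) ends-R-last
    (Q⁺ s-1<s s-1-even (kind≢ λ ()) (K⁻ s-1<s (cong not s-1-even) (kind≢ λ ()) (W⁻ (kind≢ λ ())
    (H⁻ 0<s (λ ()) (kind≢ λ ()) (K⁻ 0<s refl (kind≢ λ ()) (P⁻ (<⇒≤ 1<s) refl (kind≢ λ ())
    (L⁻ 0<s refl (index≢ (low<n z≤n) (high<n s-1<s) λ ()) here)))))))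
    where
    s-1-even : even s-1 ≡ true
    s-1-even = trans even-s-1 r-even
    open Steps (R s-1)

module Second (r : ℕ) where

  open Ladder r

  p q : ℕ → Bool
  p (suc zero) = false
  p t          = not (even t)
  q zero       = true
  q t          = not (even t)

  o : EdgeKind → ℕ → Bool
  o rim    j = not (does (j ≟ 2 + s))
  o spoke  j = if does (j ≤? s) then p j else q (j ∸ suc s)
  o innerE j = false

  O : Orientation G
  O = onIndex o

  O-L : ∀ {t} → t < s → O (L t) ≡ true
  O-L {t} t<s rewrite onIndex-idx o rim (low<n (<⇒≤ t<s))
                    | dec-false (t ≟ 2 + s) (<⇒≢ (≤-trans t<s (≤-trans (n≤1+n s) (n≤1+n _)))) = refl

  O-X : O X ≡ true
  O-X rewrite onIndex-idx o rim (low<n ≤-refl)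
            | dec-false (s ≟ 2 + s) (<⇒≢ (≤-trans (n<1+n s) (n≤1+n _))) = refl

  O-R : ∀ {t} → t < s → t ≢ 1 → O (R t) ≡ true
  O-R {t} t<s t≢1 rewrite onIndex-idx o rim (high<n t<s)
                        | dec-false (suc (t + s) ≟ 2 + s) (t≢1 ∘ +-cancelʳ-≡ s t 1 ∘ suc-injective) = refl

  O-R1 : O (R 1) ≡ false
  O-R1 rewrite onIndex-idx o rim (high<n 1<s) | dec-true (2 + s ≟ 2 + s) refl = refl

  O-P : ∀ {t} → t ≤ s → O (P t) ≡ p t
  O-P {t} t≤s rewrite onIndex-idx o spoke (low<n t≤s) | dec-true (t ≤? s) t≤s = refl

  O-Q : ∀ {t} → t < s → O (Q t) ≡ q t
  O-Q {t} t<s rewrite onIndex-idx o spoke (high<n t<s)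
                    | dec-false (suc (t + s) ≤? s) (high≰s t) | m+n∸n≡m t s = refl

  2≤⇒≢1 : ∀ {t} → 2 ≤ t → t ≢ 1
  2≤⇒≢1 (s≤s ()) refl

  O-K : ∀ t → O (K t) ≡ false
  O-K _ = refl

  O-H : ∀ t → O (H t) ≡ false
  O-H _ = refl

  O-W : O W ≡ false
  O-W = refl

  core-o : EdgeKind → ℕ → Bool
  core-o rim    j = o rim j
  core-o spoke  j = if does (j ≤? s) then false else does (j ∸ suc s ≟ 1) ∨ does (j ∸ suc s ≟ 2)
  core-o innerE j = true

  core : E G → Bool
  core = onIndex core-o

  core-P : ∀ {t} → t ≤ s → core (P t) ≡ false
  core-P {t} t≤s rewrite onIndex-idx core-o spoke (low<n t≤s) | dec-true (t ≤? s) t≤s = refl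

  core-Q : ∀ {t} → t < s → core (Q t) ≡ does (t ≟ 1) ∨ does (t ≟ 2)
  core-Q {t} t<s rewrite onIndex-idx core-o spoke (high<n t<s)
                       | dec-false (suc (t + s) ≤? s) (high≰s t) | m+n∸n≡m t s = refl

  module Steps (e : E G) where

    D : Digraph
    D = deleteArc G O e

    L⁺ : ∀ {t z} → t < s → L t ≢ e → Reach D (a (suc t)) z → Reach D (a t) z
    L⁺ {t} t<s = forward-step G O e (O-L t<s) (ends-L t)

    X⁺ : ∀ {z} → X ≢ e → Reach D (c 0) z → Reach D (a s) z
    X⁺ = forward-step G O e O-X (ends-L s)

    R⁺ : ∀ {t z} → t < s → t ≢ 1 → R t ≢ e → Reach D (c (suc t)) z → Reach D (c t) z
    R⁺ {t} t<s t≢1 = forward-step G O e (O-R t<s t≢1) (ends-R t)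

    R1⁻ : ∀ {z} → R 1 ≢ e → Reach D (c 1) z → Reach D (c 2) z
    R1⁻ = backward-step G O e O-R1 (ends-R 1)

    P⁺ : ∀ {t z} → t ≤ s → p t ≡ true → P t ≢ e → Reach D (b t) z → Reach D (a t) z
    P⁺ {t} t≤s pt = forward-step G O e (trans (O-P t≤s) pt) (ends-P t)

    P⁻ : ∀ {t z} → t ≤ s → p t ≡ false → P t ≢ e → Reach D (a t) z → Reach D (b t) z
    P⁻ {t} t≤s pt = backward-step G O e (trans (O-P t≤s) pt) (ends-P t)

    Q⁺ : ∀ {t z} → t < s → q t ≡ true → Q t ≢ e → Reach D (d t) z → Reach D (c t) z
    Q⁺ {t} t<s qt = forward-step G O e (trans (O-Q t<s) qt) (ends-Q t)

    Q⁻ : ∀ {t z} → t < s → q t ≡ false → Q t ≢ e → Reach D (c t) z → Reach D (d t) z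
    Q⁻ {t} t<s qt = backward-step G O e (trans (O-Q t<s) qt) (ends-Q t)

    K⁻ : ∀ t {z} → K t ≢ e → Reach D (b (suc t)) z → Reach D (d t) z
    K⁻ t = backward-step G O e (O-K t) (ends-K t)

    H⁻ : ∀ t {z} → H t ≢ e → Reach D (d t) z → Reach D (b t) z
    H⁻ t = backward-step G O e (O-H t) (ends-H t)

    W⁻ : ∀ {z} → W ≢ e → Reach D (b 0) z → Reach D (b s) z
    W⁻ = backward-step G O e O-W ends-W

    to-a0 : ∀ {x} → Reach D x (c s) → Reach D x (a 0)
    to-a0 = subst (Reach D _) c-s≡a-0

    L-chain : ∀ {x y} → x ≤ y → y ≤ s → (∀ t → x ≤ t → t < y → L t ≢ e) → Reach D (a x) (a y)
    L-chain x≤y y≤s L≢ = reach-chain a (λ t → t < s × L t ≢ e) (λ t (t<s , L≢e) → L⁺ t<s L≢e) x≤y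
                                     (λ t x≤t t<y → ≤-trans t<y y≤s , L≢ t x≤t t<y)

    R-chain : ∀ {x y} → 2 ≤ x → x ≤ y → y ≤ s → (∀ t → x ≤ t → t < y → R t ≢ e) → Reach D (c x) (c y)
    R-chain 2≤x x≤y y≤s R≢ =
      reach-chain c (λ t → t < s × t ≢ 1 × R t ≢ e) (λ t (t<s , t≢1 , R≢e) → R⁺ t<s t≢1 R≢e) x≤y
                  (λ t x≤t t<y → ≤-trans t<y y≤s , 2≤⇒≢1 (≤-trans 2≤x x≤t) , R≢ t x≤t t<y)

    b-chain : ∀ {x y} → x ≤ y → y ≤ s → (∀ t → x ≤ t → t < y → H t ≢ e × K t ≢ e) → Reach D (b x) (b y)
    b-chain x≤y y≤s ≢e =
      reach-chain b (λ t → H t ≢ e × K t ≢ e) (λ t (H≢e , K≢e) → H⁻ t H≢e ∘ K⁻ t K≢e) x≤y ≢e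

  module Core (e : E G) (e∉core : core e ≡ false) where

    open Steps e

    core≢ : ∀ {f} → core f ≡ true → f ≢ e
    core≢ f∈core refl = contradiction (trans (sym f∈core) e∉core) λ ()

    inner≢ : ∀ i → (innerE , i) ≢ e
    inner≢ i = core≢ refl

    L≢ : ∀ {t} → t < s → L t ≢ e
    L≢ = core≢ ∘ O-L

    R≢ : ∀ {t} → t < s → t ≢ 1 → R t ≢ e
    R≢ t<s = core≢ ∘ O-R t<s

    b→ : ∀ {x y} → x ≤ y → y ≤ s → Reach D (b x) (b y)
    b→ x≤y y≤s = b-chain x≤y y≤s λ _ _ _ → inner≢ _ , inner≢ _

    c→ : ∀ {x y} → 2 ≤ x → x ≤ y → y ≤ s → Reach D (c x) (c y)
    c→ 2≤x x≤y y≤s = R-chain 2≤x x≤y y≤s λ t x≤t t<y → R≢ (≤-trans t<y y≤s) (2≤⇒≢1 (≤-trans 2≤x x≤t))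

    b→hub : ∀ t → t ≤ s → Reach D (b t) (b 0)
    b→hub t t≤s = reach-trans (b→ t≤s ≤-refl) (W⁻ (inner≢ _) here)

    hub→b : ∀ t → t ≤ s → Reach D (b 0) (b t)
    hub→b t t≤s = b→ z≤n t≤s

    d→hub : ∀ t → t < s → Reach D (d t) (b 0)
    d→hub t t<s = K⁻ t (inner≢ _) (b→hub (suc t) t<s)

    hub→d : ∀ t → t < s → Reach D (b 0) (d t)
    hub→d t t<s = reach-trans (b→ z≤n (<⇒≤ t<s)) (H⁻ t (inner≢ _) here)

    c-1→hub : Reach D (c 1) (b 0)
    c-1→hub = Q⁺ 1<s refl (core≢ (core-Q 1<s)) (d→hub 1 1<s)

    c-0→hub : Reach D (c 0) (b 0)
    c-0→hub = R⁺ 0<s (λ ()) (R≢ 0<s λ ()) c-1→hub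

    hub→c-2 : Reach D (b 0) (c 2)
    hub→c-2 = reach-trans (hub→d 2 2<s) (Q⁻ 2<s refl (core≢ (core-Q 2<s)) here)

    a→hub : ∀ t → t ≤ s → Reach D (a t) (b 0)
    a→hub t t≤s = reach-trans (L-chain t≤s ≤-refl λ _ _ u<s → L≢ u<s) (X⁺ (core≢ O-X) c-0→hub)

    hub→a : ∀ t → t ≤ s → Reach D (b 0) (a t)
    hub→a t t≤s = reach-trans (reach-trans hub→c-2 (to-a0 (c→ ≤-refl (<⇒≤ 2<s) ≤-refl)))
                              (L-chain z≤n t≤s λ _ _ u<t → L≢ (≤-trans u<t t≤s))

    c→hub : ∀ t → t < s → Reach D (c t) (b 0)
    c→hub 0             _   = c-0→hub
    c→hub 1             _   = c-1→hub
    c→hub (suc (suc t)) t<s = reach-trans (to-a0 (c→ (s≤s (s≤s z≤n)) (<⇒≤ t<s) ≤-refl)) (a→hub 0 z≤n)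

    hub→c : ∀ t → t < s → Reach D (b 0) (c t)
    hub→c 0             _   = reach-trans (hub→a s ≤-refl) (X⁺ (core≢ O-X) here)
    hub→c 1             _   = reach-trans (hub→c 0 0<s) (R⁺ 0<s (λ ()) (R≢ 0<s λ ()) here)
    hub→c (suc (suc t)) t<s = reach-trans hub→c-2 (c→ ≤-refl (s≤s (s≤s z≤n)) (<⇒≤ t<s))

    stronglyConnected-minus : StronglyConnected D
    stronglyConnected-minus = stronglyConnected-via (b 0)
      (vertex-cases (λ x → Reach D x (b 0)) a→hub c→hub b→hub d→hub)
      (vertex-cases (λ x → Reach D (b 0) x) hub→a hub→c hub→b hub→d)

  deletable-outside-core : ∀ e → core e ≡ false → Deletable G O e
  deletable-outside-core = Core.stronglyConnected-minus

  stronglyConnected : StronglyConnected (oriented G O)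
  stronglyConnected = stronglyConnected-if-deletable G O (R 1) (deletable-outside-core (R 1) O-R1)

  deletable-forward : ∀ f {x y} → O f ≡ true → ends G f ≡ (x , y) →
                      Reach (deleteArc G O f) x y → Deletable G O f
  deletable-forward f o ends≡ =
    deletable-by-bypass G O f _≟ₑ_ stronglyConnected (arc-forward G O {f} o ends≡)

  deletable-backward : ∀ f {x y} → O f ≡ false → ends G f ≡ (y , x) →
                       Reach (deleteArc G O f) x y → Deletable G O f
  deletable-backward f o ends≡ =
    deletable-by-bypass G O f _≟ₑ_ stronglyConnected (arc-backward G O {f} o ends≡)

  deletable-L-odd : ∀ u → even u ≡ false → 2 + u < s → Deletable G O (L (2 + u))
  deletable-L-odd u odd t<s = deletable-forward (L t) (O-L t<s) (ends-L t)
    (P⁺ (<⇒≤ t<s) (cong not odd-t) (kind≢ λ ()) (H⁻ t (kind≢ λ ()) (K⁻ t (kind≢ λ ())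
    (P⁻ t<s (cong (not ∘ not) odd-t) (kind≢ λ ()) here))))
    where
    t = 2 + u
    odd-t : even t ≡ false
    odd-t = trans (even-+2 u) odd
    open Steps (L t)

  deletable-R-odd : ∀ u → even u ≡ false → 3 + u < s → Deletable G O (R (2 + u))
  deletable-R-odd u odd t+1<s = deletable-forward (R t) (O-R t<s λ ()) (ends-R t)
    (Q⁺ t<s (cong not odd-t) (kind≢ λ ()) (K⁻ t (kind≢ λ ()) (H⁻ (suc t) (kind≢ λ ())
    (Q⁻ t+1<s (cong (not ∘ not) odd-t) (kind≢ λ ()) here))))
    where
    t = 2 + u
    t<s : t < s
    t<s = <⇒≤ t+1<s
    odd-t : even t ≡ false
    odd-t = trans (even-+2 u) odd
    open Steps (R t)

  deletable-R0 : Deletable G O (R 0)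
  deletable-R0 = deletable-forward (R 0) (O-R 0<s λ ()) (ends-R 0)
    (Q⁺ 0<s refl (kind≢ λ ()) (K⁻ 0 (kind≢ λ ()) (H⁻ 1 (kind≢ λ ()) (K⁻ 1 (kind≢ λ ())
    (H⁻ 2 (kind≢ λ ()) (Q⁻ 2<s refl (kind≢ λ ()) (R1⁻ (index≢ (high<n 1<s) (high<n 0<s) λ ()) here)))))))
    where open Steps (R 0)

  deletable-K-even : ∀ u → even u ≡ true → 2 + u < s → Deletable G O (K (2 + u))
  deletable-K-even u ev t<s = deletable-backward (K t) (O-K t) (ends-K t)
    (Q⁻ t<s (cong not even-t) (kind≢ λ ())
    (reach-trans (to-a0 (R-chain (s≤s (s≤s z≤n)) (<⇒≤ t<s) ≤-refl λ _ _ _ → kind≢ λ ()))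
    (reach-trans (L-chain z≤n t<s λ _ _ _ → kind≢ λ ())
    (P⁺ t<s (cong (not ∘ not) even-t) (kind≢ λ ()) here))))
    where
    t = 2 + u
    even-t : even t ≡ true
    even-t = trans (even-+2 u) ev
    open Steps (K t)

  deletable-H0 : Deletable G O (H 0)
  deletable-H0 = deletable-backward (H 0) (O-H 0) (ends-H 0)
    (P⁻ z≤n refl (kind≢ λ ()) (reach-trans (L-chain z≤n ≤-refl λ _ _ _ → kind≢ λ ())
    (X⁺ (kind≢ λ ()) (Q⁺ 0<s refl (kind≢ λ ()) here))))
    where open Steps (H 0)

  deletable-H1 : Deletable G O (H 1)
  deletable-H1 = deletable-backward (H 1) (O-H 1) (ends-H 1)
    (P⁻ (<⇒≤ 1<s) refl (kind≢ λ ()) (reach-trans (L-chain (s≤s z≤n) ≤-refl λ _ _ _ → kind≢ λ ())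
    (X⁺ (kind≢ λ ()) (R⁺ 0<s (λ ()) (kind≢ λ ()) (Q⁺ 1<s refl (kind≢ λ ()) here)))))
    where open Steps (H 1)

  deletable-R-last : even r ≡ false → Deletable G O (R s-1)
  deletable-R-last r-odd = deletable-forward (R s-1) (O-R s-1<s λ ()) ends-R-last
    (Q⁺ s-1<s (cong not (trans even-s-1 r-odd)) (kind≢ λ ()) (K⁻ s-1 (kind≢ λ ())
    (W⁻ (kind≢ λ ()) (P⁻ z≤n refl (kind≢ λ ()) here))))
    where open Steps (R s-1)

module Bounds (r : ℕ) where

  open Ladder r
  module ₁ = First r
  module ₂ = Second r

  a-0-only : ∀ {j} → j < n → (outer , idx j) ≡ a 0 → j ≡ 0
  a-0-only j<n = idx-injective j<n (low<n z≤n)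

  IncidentAt-a-0 : E G → Set
  IncidentAt-a-0 f = Incident G (a 0) f → f ≡ L 0 ⊎ f ≡ R s-1 ⊎ f ≡ P 0

  incident-a-0 : ∀ f → IncidentAt-a-0 f
  incident-a-0 = edge-cases IncidentAt-a-0 inc-L inc-R inc-P inc-Q inc-W inc-K inc-H
    where
    inc-L : ∀ t → t ≤ s → IncidentAt-a-0 (L t)
    inc-L t t≤s (inj₁ eq) with a-0-only (low<n t≤s) eq
    ... | refl = inj₁ refl
    inc-L t t≤s (inj₂ eq)
      with a-0-only (≤-<-trans (s≤s t≤s) (high<n 0<s)) (trans (sym (cong proj₂ (ends-L t))) eq)
    ... | ()
    inc-R : ∀ t → t < s → IncidentAt-a-0 (R t)
    inc-R t t<s (inj₁ eq) with a-0-only (high<n t<s) eq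
    ... | ()
    inc-R t t<s (inj₂ eq) with m≤n⇒m<n∨m≡n t<s
    ... | inj₂ refl = inj₂ (inj₁ refl)
    ... | inj₁ t+1<s with a-0-only (high<n t+1<s) (trans (sym (cong proj₂ (ends-R t))) eq)
    ...   | ()
    inc-P : ∀ t → t ≤ s → IncidentAt-a-0 (P t)
    inc-P t t≤s (inj₁ eq) with a-0-only (low<n t≤s) eq
    ... | refl = inj₂ (inj₂ refl)
    inc-P t t≤s (inj₂ ())
    inc-Q : ∀ t → t < s → IncidentAt-a-0 (Q t)
    inc-Q t t<s (inj₁ eq) with a-0-only (high<n t<s) eq
    ... | ()
    inc-Q t t<s (inj₂ ())
    inc-W : IncidentAt-a-0 W
    inc-W (inj₁ ())
    inc-W (inj₂ ())
    inc-K : ∀ t → t < s → IncidentAt-a-0 (K t)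
    inc-K t t<s (inj₁ ())
    inc-K t t<s (inj₂ ())
    inc-H : ∀ t → t < s → IncidentAt-a-0 (H t)
    inc-H t t<s (inj₁ ())
    inc-H t t<s (inj₂ ())

  ¬all-deletable : ∀ O → ¬ (∀ e → Deletable G O e)
  ¬all-deletable O = degree-three⇒¬all-deletable G O {y = b 0} (λ ()) incident-a-0
    (direction G O a-1≢a-0 (inj₁ (ends-L 0)))
    (direction G O c≢a-0 (inj₂ ends-R-last))
    (direction G O (λ ()) (inj₁ refl))
    where
    a-1≢a-0 : a 1 ≢ a 0
    a-1≢a-0 = index≢ (low<n (<⇒≤ 1<s)) (low<n z≤n) λ ()
    c≢a-0 : c s-1 ≢ a 0
    c≢a-0 = index≢ (high<n ≤-refl) (low<n z≤n) λ ()

  orientations : Fin 2 → Orientation G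
  orientations fzero        = ₁.O
  orientations (fsuc fzero) = ₂.O

  Covered : E G → Set
  Covered f = ∃ λ i → Deletable G (orientations i) f

  first : ∀ {f} → Deletable G ₁.O f → Covered f
  first del = fzero , del

  second : ∀ {f} → Deletable G ₂.O f → Covered f
  second del = fsuc fzero , del

  covered-L : ∀ t → t ≤ s → Covered (L t)
  covered-L t t≤s with m≤n⇒m<n∨m≡n t≤s
  covered-L t t≤s | inj₂ refl = first ₁.deletable-X
  covered-L t t≤s | inj₁ t<s with parity t
  covered-L t             _ | inj₁ t<s | inj₁ ev  =
    first (₁.deletable-outside-core _ (trans (₁.O-L t<s) (cong not ev)))
  covered-L zero          _ | inj₁ _   | inj₂ ()
  covered-L 1             _ | inj₁ _   | inj₂ _   = first ₁.deletable-L1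
  covered-L (suc (suc u)) _ | inj₁ t<s | inj₂ odd =
    second (₂.deletable-L-odd u (trans (sym (even-+2 u)) odd) t<s)

  covered-R : ∀ t → t < s → Covered (R t)
  covered-R 0 _ = second ₂.deletable-R0
  covered-R 1 _ = second (₂.deletable-outside-core (R 1) ₂.O-R1)
  covered-R (suc (suc u)) t<s with m≤n⇒m<n∨m≡n t<s | parity u
  ... | inj₂ refl  | inj₁ ev  = first (₁.deletable-R-last ev)
  ... | inj₂ refl  | inj₂ odd = second (₂.deletable-R-last odd)
  ... | inj₁ t+1<s | inj₁ ev  = first (₁.deletable-R-even u ev t+1<s)
  ... | inj₁ t+1<s | inj₂ odd = second (₂.deletable-R-odd u odd t+1<s)

  covered-P : ∀ t → t ≤ s → Covered (P t)
  covered-P t t≤s = second (₂.deletable-outside-core _ (₂.core-P t≤s))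

  covered-Q : ∀ t → t < s → Covered (Q t)
  covered-Q 1 _   = first ₁.deletable-Q1
  covered-Q 2 t<s = first (₁.deletable-outside-core _ (₁.core-Q t<s))
  covered-Q 0 t<s = second (₂.deletable-outside-core _ (₂.core-Q t<s))
  covered-Q (suc (suc (suc u))) t<s = second (₂.deletable-outside-core _ (₂.core-Q t<s))

  covered-K : ∀ t → t < s → Covered (K t)
  covered-K t t<s with parity (suc t)
  covered-K t             t<s | inj₁ ev  =
    first (₁.deletable-outside-core _ (trans (₁.core-K t<s) (cong not ev)))
  covered-K 0             _   | inj₂ _   = first ₁.deletable-K0
  covered-K 1             _   | inj₂ ()
  covered-K (suc (suc u)) t<s | inj₂ odd =
    second (₂.deletable-K-even u (trans (sym (even-+2 u)) (odd-suc⇒even (2 + u) odd)) t<s)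

  covered-H : ∀ t → t < s → Covered (H t)
  covered-H 0 _ = second ₂.deletable-H0
  covered-H 1 _ = second ₂.deletable-H1
  covered-H 2 _ = first ₁.deletable-H2
  covered-H (suc (suc (suc u))) t<s with parity u
  covered-H (suc (suc (suc u)))       t<s | inj₁ ev  = first (₁.deletable-H-odd (suc u) (cong not ev) t<s)
  covered-H 3                         _   | inj₂ ()
  covered-H (suc (suc (suc (suc v)))) t<s | inj₂ odd = first (₁.deletable-H-even v (odd-suc⇒even v odd) t<s)

  covering : CoveringFamily G 2
  covering = orientations ,
    edge-cases Covered covered-L covered-R covered-P covered-Q (first ₁.deletable-W) covered-K covered-H

theorem6p2 : ∀ (s : ℕ) → 3 ≤ s → FrankNumber (GP (suc (2 * s)) s) 2
theorem6p2 (suc (suc (suc r))) (s≤s (s≤s (s≤s z≤n))) =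
  frankNumber-two (Ladder.G r) (Ladder.W r) (Bounds.¬all-deletable r) (Bounds.covering r)
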